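{- A diagram $D$ is northeast if and only if the super-standard labeling of $D$ is a northeast labeling.
   Context: A diagram is a finite subset of $\mathbb{N}\times\mathbb{N}$; $(r,c)$ is a cell in row $r$, column $c$, rows numbered bottom to top. $D$ is northeast if for all cells $(r_1,c_1),(r_2,c_2)\in D$, $(\max(r_1,r_2),\max(c_1,c_2))\in D$. A labeling is a map $\mathcal{L}:D\to\mathbb{N}$; the super-standard labeling labels each cell by its row index; a labeling is strict if labels strictly increase bottom to top in each column. A northeast labeling is a labeling such that: (1) it is strict; (2) each label in row $i$ is at least $i$; (3) if $x'$ is in a column strictly to the right of $x$ and $\mathcal{L}(x')<\mathcal{L}(x)$, then some cell $x''$ in the column of $x'$ has $\mathcal{L}(x'')=\mathcal{L}(x)$; (4) if $x'$ is in a column strictly to the right of $x$ and $\mathcal{L}(x')=\mathcal{L}(x)$, then $x'$ is weakly below $x$. -}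

module Defs where

open import Data.Nat using (ℕ; _<_; _≤_; _⊔_)
open import Data.Product using (_×_; _,_; ∃-syntax; proj₁; proj₂)
open import Data.List using (List)
open import Data.List.Membership.Propositional using (_∈_)
open import Relation.Binary.PropositionalEquality using (_≡_)

-- A cell (r , c): row r (numbered bottom to top), column c.
Cell : Set
Cell = ℕ × ℕ

row col : Cell → ℕ
row = proj₁
col = proj₂

-- A diagram is a finite subset of ℕ × ℕ, represented by a finite list of its
-- cells (membership is list membership; repetitions are irrelevant).
Diagram : Set
Diagram = List Cell

IsNortheast : Diagram → Set
IsNortheast D = ∀ r₁ c₁ r₂ c₂ → (r₁ , c₁) ∈ D → (r₂ , c₂) ∈ D →
  (r₁ ⊔ r₂ , c₁ ⊔ c₂) ∈ D

-- A labeling of D: a map from cells to ℕ; only its values on cells of D matter.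
Labeling : Set
Labeling = Cell → ℕ

superStandard : Labeling
superStandard x = row x

IsStrict : Diagram → Labeling → Set
IsStrict D L = ∀ x y → x ∈ D → y ∈ D → col x ≡ col y → row x < row y → L x < L y

RowBounded : Diagram → Labeling → Set
RowBounded D L = ∀ x → x ∈ D → row x ≤ L x

Cond3 : Diagram → Labeling → Set
Cond3 D L = ∀ x x′ → x ∈ D → x′ ∈ D → col x < col x′ → L x′ < L x →
  ∃[ x″ ] (x″ ∈ D × col x″ ≡ col x′ × L x″ ≡ L x)

Cond4 : Diagram → Labeling → Set
Cond4 D L = ∀ x x′ → x ∈ D → x′ ∈ D → col x < col x′ → L x′ ≡ L x →
  row x′ ≤ row x

IsNortheastLabeling : Diagram → Labeling → Set
IsNortheastLabeling D L = IsStrict D L × RowBounded D L × Cond3 D L × Cond4 D L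

-- Conditions (1), (2) and (4) hold for the super-standard labeling of any
-- diagram, so everything rests on condition (3). For cells (r₁ , c₁) and
-- (r₂ , c₂) with c₁ < c₂ and r₂ < r₁, condition (3) asks for a cell in column
-- c₂ labeled r₁, i.e. exactly for the cell (r₁ , c₂) = (r₁ ⊔ r₂ , c₁ ⊔ c₂).
-- In every other configuration the join of two cells is one of them.
module Submission where

open import Defs
open import Function.Bundles using (_⇔_; mk⇔)
open import Data.Nat using (_≤_; _⊔_; _≤?_)
open import Data.Nat.Properties
  using (≤-refl; ≤-reflexive; ≤-total; <⇒≤; ≰⇒>; m≤n⇒m<n∨m≡n; m≤n⇒m⊔n≡n; m≥n⇒m⊔n≡m; ⊔-comm)
open import Data.Product using (_,_)
open import Data.Sum using (inj₁; inj₂)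
open import Data.List.Membership.Propositional using (_∈_)
open import Relation.Nullary using (yes; no)
open import Relation.Binary.PropositionalEquality using (refl; sym; subst; cong₂)

superStandard-isStrict : ∀ D → IsStrict D superStandard
superStandard-isStrict D x y _ _ _ row-x<row-y = row-x<row-y

superStandard-rowBounded : ∀ D → RowBounded D superStandard
superStandard-rowBounded D x _ = ≤-refl

superStandard-cond4 : ∀ D → Cond4 D superStandard
superStandard-cond4 D x x′ _ _ _ row-x′≡row-x = ≤-reflexive row-x′≡row-x

northeast⇒cond3 : ∀ {D} → IsNortheast D → Cond3 D superStandard
northeast⇒cond3 ne (r , c) (r′ , c′) x∈D x′∈D c<c′ r′<r =
  (r ⊔ r′ , c ⊔ c′) , ne r c r′ c′ x∈D x′∈D ,
  m≤n⇒m⊔n≡n (<⇒≤ c<c′) , m≥n⇒m⊔n≡m (<⇒≤ r′<r)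

northeast-fromOrderedColumns : ∀ {D} →
  (∀ r₁ c₁ r₂ c₂ → c₁ ≤ c₂ → (r₁ , c₁) ∈ D → (r₂ , c₂) ∈ D → (r₁ ⊔ r₂ , c₂) ∈ D) →
  IsNortheast D
northeast-fromOrderedColumns {D} join r₁ c₁ r₂ c₂ m₁ m₂ with ≤-total c₁ c₂
... | inj₁ c₁≤c₂ =
  subst (λ c → (r₁ ⊔ r₂ , c) ∈ D) (sym (m≤n⇒m⊔n≡n c₁≤c₂)) (join r₁ c₁ r₂ c₂ c₁≤c₂ m₁ m₂)
... | inj₂ c₂≤c₁ =
  subst (_∈ D) (cong₂ _,_ (⊔-comm r₂ r₁) (sym (m≥n⇒m⊔n≡m c₂≤c₁))) (join r₂ c₂ r₁ c₁ c₂≤c₁ m₂ m₁)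

cond3⇒northeast : ∀ {D} → Cond3 D superStandard → IsNortheast D
cond3⇒northeast {D} cond3 = northeast-fromOrderedColumns join
  where
  join : ∀ r₁ c₁ r₂ c₂ → c₁ ≤ c₂ → (r₁ , c₁) ∈ D → (r₂ , c₂) ∈ D → (r₁ ⊔ r₂ , c₂) ∈ D
  join r₁ c₁ r₂ c₂ c₁≤c₂ m₁ m₂ with r₁ ≤? r₂
  ... | yes r₁≤r₂ = subst (λ r → (r , c₂) ∈ D) (sym (m≤n⇒m⊔n≡n r₁≤r₂)) m₂
  ... | no r₁≰r₂ with ≰⇒> r₁≰r₂ | m≤n⇒m<n∨m≡n c₁≤c₂
  ...   | r₂<r₁ | inj₂ refl = subst (λ r → (r , c₁) ∈ D) (sym (m≥n⇒m⊔n≡m (<⇒≤ r₂<r₁))) m₁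
  ...   | r₂<r₁ | inj₁ c₁<c₂ with cond3 (r₁ , c₁) (r₂ , c₂) m₁ m₂ c₁<c₂ r₂<r₁
  ...     | _ , m , refl , refl = subst (λ r → (r , c₂) ∈ D) (sym (m≥n⇒m⊔n≡m (<⇒≤ r₂<r₁))) m

lemma2p11 : (D : Diagram) → IsNortheast D ⇔ IsNortheastLabeling D superStandard
lemma2p11 D = mk⇔
  (λ ne → superStandard-isStrict D , superStandard-rowBounded D ,
          northeast⇒cond3 ne , superStandard-cond4 D)
  (λ (_ , _ , cond3 , _) → cond3⇒northeast cond3)
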